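{- Let $n\in\mathbb{N}$ and let $a_1,a_2,a_3$ be distinct divisors of $n$. Taking indices on the $a$'s modulo $3$, define for $1\le i\le 3$ $$H_i=\bigcup_{r=0}^{\gcd(a_i,a_{i+1})-1}(r+a_i\mathbb{Z}_n).$$ Then $\{H_1,H_2,H_3\}$ is a non-disjoint $\big(n,3,\frac{n}{a_1}\gcd(a_1,a_2),\frac{n}{a_2}\gcd(a_2,a_3),\frac{n}{a_3}\gcd(a_3,a_1)\big)$-GPSEDF in $\mathbb{Z}_n$ with $\lambda_{i,i+1}=\lambda_{i+1,i}=\frac{n\gcd(a_{i+1},a_{i+2})}{\operatorname{lcm}(a_i,a_{i+1})}$.
   Context: For a divisor $a$ of $n$, $a\mathbb{Z}_n=\{0,a,2a,\dots,n-a\}$ denotes the additive subgroup of $\mathbb{Z}_n$ generated by $a$, and $r+S=\{r+s:s\in S\}$. For subsets $A,B$ of $\mathbb{Z}_n$, $\Delta(A,B)$ denotes the multiset $\{x-y:x\in A,y\in B\}$ (one entry per pair). A family of sets $\{A_1,\dots,A_m\}$ in $\mathbb{Z}_n$ with $|A_i|=k_i$ is a non-disjoint $(n,m,k_1,\dots,k_m)$-GPSEDF if for all $i\ne j$, $\Delta(A_i,A_j)$ contains every element of $\mathbb{Z}_n$ exactly $\lambda_{i,j}=k_ik_j/n$ times. -}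

module Defs where

open import Data.Nat using (ℕ; zero; suc; _+_; _*_; _∸_; NonZero)
open import Data.Nat.DivMod using (_%_; m%n<n)
open import Data.Bool using (Bool; true; false; _∧_; if_then_else_)
open import Data.Fin using (Fin; toℕ; fromℕ<; _≟_)
open import Data.Fin.Subset using (Subset; ⁅_⁆; ⋃; ∣_∣; ⊥)
open import Data.Vec using (lookup)
open import Data.List using (List; map; upTo; allFin)
open import Data.Nat.ListAction using (sum)
open import Data.Nat.GCD using (gcd)
open import Relation.Nullary using (does; ¬_)
open import Relation.Binary.PropositionalEquality using (_≡_)

[_]ₙ : ∀ {n} .{{_ : NonZero n}} → ℕ → Fin n
[_]ₙ {n} m = fromℕ< (m%n<n m n)

_⊖_ : ∀ {n} .{{_ : NonZero n}} → Fin n → Fin n → Fin n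
_⊖_ {n} x y = [ toℕ x + (n ∸ toℕ y) ]ₙ

-- a ℤ_n = {0, a, 2a, ...}: the additive subgroup generated by a,
-- i.e. { t·a mod n : t ∈ ℕ } (t < n suffices).
_ℤ[_] : ℕ → (n : ℕ) .{{_ : NonZero n}} → Subset n
a ℤ[ n ] = ⋃ (map (λ t → ⁅ [ t * a ]ₙ ⁆) (upTo n))

_+ˢ_ : ∀ {n} .{{_ : NonZero n}} → ℕ → Subset n → Subset n
_+ˢ_ {n} r S =
  ⋃ (map (λ s → if lookup S s then ⁅ [ r + toℕ s ]ₙ ⁆ else ⊥) (allFin n))

Δ-count : ∀ {n} .{{_ : NonZero n}} → Subset n → Subset n → Fin n → ℕ
Δ-count {n} A B z =
  sum (map (λ x → sum (map (λ y →
    if lookup A x ∧ lookup B y ∧ does ((x ⊖ y) ≟ z) then 1 else 0)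
    (allFin n))) (allFin n))

-- {A_1,...,A_m} is a non-disjoint (n,m,k_1,...,k_m)-GPSEDF in ℤ_n
-- with parameters λ_{i,j}: |A_i| = k_i, λ_{i,j} = k_i k_j / n (stated
-- multiplicatively: λ_{i,j} · n = k_i k_j), and for i ≠ j every z ∈ ℤ_n
-- occurs exactly λ_{i,j} times in Δ(A_i,A_j).
record IsGPSEDF (n m : ℕ) .{{_ : NonZero n}} (A : Fin m → Subset n)
                (k : Fin m → ℕ) (λ' : Fin m → Fin m → ℕ) : Set where
  field
    sizes   : ∀ i → ∣ A i ∣ ≡ k i
    λ-value : ∀ i j → ¬ (i ≡ j) → λ' i j * n ≡ k i * k j
    Δ-exact : ∀ i j → ¬ (i ≡ j) → ∀ z → Δ-count (A i) (A j) z ≡ λ' i j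

next : Fin 3 → Fin 3
next Fin.zero = Fin.suc Fin.zero
next (Fin.suc Fin.zero) = Fin.suc (Fin.suc Fin.zero)
next (Fin.suc (Fin.suc Fin.zero)) = Fin.zero

H : (n : ℕ) .{{_ : NonZero n}} → (Fin 3 → ℕ) → Fin 3 → Subset n
H n a i = ⋃ (map (λ r → r +ˢ (a i ℤ[ n ])) (upTo (gcd (a i) (a (next i)))))

{-# OPTIONS --safe #-}
-- The set H_i is {x : x mod a_i < d_i} with d_i = gcd(a_i, a_{i+1}). Viewing a subset A of
-- ℤ_n as an n-periodic 0/1 function 𝟙[A] on ℕ, the count of z in Δ(A,B) is the correlation
-- ∑_y 𝟙[B](y)·𝟙[A](z+y), and once this is independent of z its value λ satisfies
-- n·λ = |A|·|B|.  Since m mod a < d iff exactly one of the d consecutive numbers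
-- m+(a-d)+1, …, m+a is a multiple of a, the correlation of 𝟙[H_i] with any a_{i+1}-periodic
-- β is a sum of F(v) = ∑_y β(y)·[a_i ∣ v+y] over d_i consecutive values of v. F has period a_i,
-- and period a_{i+1} through β, hence period d_i by Bézout, so that sum does not depend on z.
-- Uniformity of Δ(H_{i+1},H_i) follows because it is Δ(H_i,H_{i+1}) reflected, and
-- λ·lcm = n·gcd follows from gcd·lcm = a_i·a_{i+1}.
module Submission where

open import Defs
open import Data.Nat
  using (ℕ; zero; suc; pred; _+_; _*_; _∸_; _≤_; _<_; z≤n; s≤s; s≤s⁻¹; z<s; NonZero; ≢-nonZero; ≢-nonZero⁻¹)
open import Data.Nat.Properties
open import Algebra.Properties.CommutativeSemigroup +-commutativeSemigroup
  using (interchange; x∙yz≈y∙xz; xy∙z≈xz∙y)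
open import Algebra.Properties.CommutativeSemigroup *-commutativeSemigroup
  using () renaming (x∙yz≈y∙xz to x*yz≡y*xz)
open import Data.Nat.DivMod
open import Data.Nat.Divisibility
  using (_∣_; divides; quotient; _∣?_; ∣-refl; ∣⇒≤; 0∣⇒≡0; m%n≡0⇒n∣m; ∣m∣n⇒∣m+n; ∣m+n∣m⇒∣n; n∣m*n)
open import Data.Nat.GCD using (gcd; gcd-GCD; gcd[m,n]∣m; gcd[m,n]≢0; module Bézout)
open import Data.Nat.Solver using (module +-*-Solver)
open import Data.Nat.LCM using (lcm; gcd*lcm)
open import Data.Fin using (Fin; toℕ; fromℕ<) renaming (zero to fzero; suc to fsuc; _≟_ to _≟ᶠ_)
open import Data.Fin.Properties using (toℕ<n; toℕ-fromℕ<; toℕ-injective)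
open import Data.Fin.Subset using (Subset; ∣_∣; _∈_; ⋃; ⁅_⁆; ⊥)
open import Data.Fin.Subset.Properties using (x∈p∪q⁺; x∈p∪q⁻; ∉⊥; x∈⁅x⁆; x∈⁅y⁆⇒x≡y)
open import Data.Vec using (lookup; []; _∷_)
open import Data.Vec.Properties using ([]=⇒lookup; lookup⇒[]=)
open import Data.List using (List; map; upTo; allFin; tabulate)
open import Data.List.Membership.Propositional using () renaming (_∈_ to _∈ˡ_)
open import Data.List.Membership.Propositional.Properties
  using (∈-map⁺; ∈-map⁻; ∈-upTo⁺; ∈-upTo⁻; ∈-allFin)
open import Data.List.Relation.Unary.Any using (here; there)
open import Data.List.Properties using (map-tabulate)
open import Data.Nat.ListAction using (sum)
open import Data.Bool using (Bool; true; false; if_then_else_; _∧_)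
open import Data.Product using (Σ; _×_; _,_; ∃-syntax)
open import Data.Sum using (_⊎_; inj₁; inj₂)
open import Data.Empty using (⊥-elim)
open import Function using (_∘_; _⇔_; mk⇔; Equivalence)
open import Relation.Nullary using (¬_; Dec; does; yes; no)
open import Relation.Nullary.Decidable using (does-⇔; dec-true; dec-false)
open import Relation.Binary.Definitions using (tri<; tri≈; tri>)
open import Relation.Binary.PropositionalEquality
open ≡-Reasoning

∑< : ℕ → (ℕ → ℕ) → ℕ
∑< zero    f = 0
∑< (suc n) f = f 0 + ∑< n (λ x → f (suc x))

infix 5 ∑<
syntax ∑< n (λ x → e) = ∑[ x < n ] e

∑-cong : ∀ n {f g : ℕ → ℕ} → (∀ x → x < n → f x ≡ g x) → ∑< n f ≡ ∑< n g
∑-cong zero    _  = refl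
∑-cong (suc n) eq = cong₂ _+_ (eq 0 (s≤s z≤n)) (∑-cong n (λ x x<n → eq (suc x) (s≤s x<n)))

∑-cong′ : ∀ n {f g : ℕ → ℕ} → (∀ x → f x ≡ g x) → ∑< n f ≡ ∑< n g
∑-cong′ n eq = ∑-cong n (λ x _ → eq x)

∑-last : ∀ n (f : ℕ → ℕ) → ∑< (suc n) f ≡ ∑< n f + f n
∑-last zero    f = +-comm (f 0) 0
∑-last (suc n) f = begin
  f 0 + ∑< (suc n) (λ x → f (suc x))        ≡⟨ cong (f 0 +_) (∑-last n (λ x → f (suc x))) ⟩
  f 0 + (∑< n (λ x → f (suc x)) + f (suc n)) ≡⟨ +-assoc (f 0) _ _ ⟨
  ∑< (suc n) f + f (suc n)                   ∎

∑-distrib-+ : ∀ n (f g : ℕ → ℕ) → ∑[ x < n ] (f x + g x) ≡ ∑< n f + ∑< n g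
∑-distrib-+ zero    f g = refl
∑-distrib-+ (suc n) f g = begin
  f 0 + g 0 + (∑[ x < n ] f (suc x) + g (suc x))              ≡⟨ cong (f 0 + g 0 +_) (∑-distrib-+ n _ _) ⟩
  f 0 + g 0 + (∑< n (λ x → f (suc x)) + ∑< n (λ x → g (suc x))) ≡⟨ interchange (f 0) (g 0) _ _ ⟩
  ∑< (suc n) f + ∑< (suc n) g                                  ∎

*-distribˡ-∑ : ∀ n c (f : ℕ → ℕ) → c * ∑< n f ≡ ∑[ x < n ] (c * f x)
*-distribˡ-∑ zero    c f = *-zeroʳ c
*-distribˡ-∑ (suc n) c f = trans (*-distribˡ-+ c (f 0) _) (cong (c * f 0 +_) (*-distribˡ-∑ n c _))

∑-const : ∀ n c → ∑[ _ < n ] c ≡ n * c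
∑-const zero    c = refl
∑-const (suc n) c = cong (c +_) (∑-const n c)

∑-comm : ∀ m n (f : ℕ → ℕ → ℕ) → ∑[ x < m ] ∑[ y < n ] f x y ≡ ∑[ y < n ] ∑[ x < m ] f x y
∑-comm zero    n f = sym (trans (∑-const n 0) (*-zeroʳ n))
∑-comm (suc m) n f = begin
  ∑< n (f 0) + (∑[ x < m ] ∑[ y < n ] f (suc x) y) ≡⟨ cong (∑< n (f 0) +_) (∑-comm m n _) ⟩
  ∑< n (f 0) + (∑[ y < n ] ∑[ x < m ] f (suc x) y) ≡⟨ ∑-distrib-+ n _ _ ⟨
  ∑[ y < n ] ∑[ x < suc m ] f x y                  ∎

∑-++ : ∀ m k (f : ℕ → ℕ) → ∑< (m + k) f ≡ ∑< m f + (∑[ x < k ] f (m + x))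
∑-++ zero    k f = refl
∑-++ (suc m) k f = trans (cong (f 0 +_) (∑-++ m k _)) (sym (+-assoc (f 0) _ _))

-- Periodic functions

Periodic : ℕ → (ℕ → ℕ) → Set
Periodic p f = ∀ m → f (m + p) ≡ f m

∑-rotate : ∀ n (f : ℕ → ℕ) → f n ≡ f 0 → ∑[ x < n ] f (suc x) ≡ ∑< n f
∑-rotate n f fn≡f0 = +-cancelˡ-≡ (f 0) _ _ (begin
  ∑< (suc n) f   ≡⟨ ∑-last n f ⟩
  ∑< n f + f n   ≡⟨ cong (∑< n f +_) fn≡f0 ⟩
  ∑< n f + f 0   ≡⟨ +-comm _ (f 0) ⟩
  f 0 + ∑< n f   ∎)

∑-shift : ∀ n {f : ℕ → ℕ} → Periodic n f → ∀ c → ∑[ x < n ] f (c + x) ≡ ∑< n f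
∑-shift n         _   zero    = refl
∑-shift n {f} per (suc c) = begin
  ∑[ x < n ] f (suc (c + x))   ≡⟨ ∑-cong′ n (λ x → cong f (+-suc c x)) ⟨
  ∑[ x < n ] f (c + suc x)     ≡⟨ ∑-rotate n (λ x → f (c + x)) (trans (per c) (cong f (sym (+-identityʳ c)))) ⟩
  ∑[ x < n ] f (c + x)         ≡⟨ ∑-shift n per c ⟩
  ∑< n f                       ∎

periodic-* : ∀ {p f} → Periodic p f → ∀ k → Periodic (k * p) f
periodic-* {f = f} per zero    m = cong f (+-identityʳ m)
periodic-* {p} {f} per (suc k) m = begin
  f (m + (p + k * p)) ≡⟨ cong f (+-assoc m p (k * p)) ⟨
  f (m + p + k * p)   ≡⟨ periodic-* per k (m + p) ⟩
  f (m + p)           ≡⟨ per m ⟩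
  f m                 ∎

periodic-∣ : ∀ {p q f} → p ∣ q → Periodic p f → Periodic q f
periodic-∣ (divides k refl) per = periodic-* per k

periodic-% : ∀ {n f} .{{_ : NonZero n}} → Periodic n f → ∀ m → f (m % n) ≡ f m
periodic-% {n} {f} per m = sym (trans (cong f (m≡m%n+[m/n]*n m n)) (periodic-* per (m / n) (m % n)))

periodic-gcd : ∀ {a b f} → Periodic a f → Periodic b f → Periodic (gcd a b) f
periodic-gcd {a} {b} {f} per-a per-b m with Bézout.identity (gcd-GCD a b)
... | Bézout.+- x y eq = begin
  f (m + gcd a b)         ≡⟨ periodic-* per-b y _ ⟨
  f (m + gcd a b + y * b) ≡⟨ cong f (trans (+-assoc m _ _) (cong (m +_) eq)) ⟩
  f (m + x * a)           ≡⟨ periodic-* per-a x m ⟩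
  f m                     ∎
... | Bézout.-+ x y eq = begin
  f (m + gcd a b)         ≡⟨ periodic-* per-a x _ ⟨
  f (m + gcd a b + x * a) ≡⟨ cong f (trans (+-assoc m _ _) (cong (m +_) eq)) ⟩
  f (m + y * b)           ≡⟨ periodic-* per-b y m ⟩
  f m                     ∎

χ : Bool → ℕ
χ b = if b then 1 else 0

χ-∧ : ∀ p q → χ (p ∧ q) ≡ χ p * χ q
χ-∧ true  q = sym (+-identityʳ (χ q))
χ-∧ false q = refl

∑-δ : ∀ n (f : ℕ → ℕ) {w} → w < n → ∑[ x < n ] f x * χ (does (x ≟ w)) ≡ f w
∑-δ (suc n) f {zero}  _         = begin
  f 0 * 1 + (∑[ x < n ] f (suc x) * 0) ≡⟨ cong₂ _+_ (*-identityʳ (f 0)) (∑-cong′ n (*-zeroʳ ∘ f ∘ suc)) ⟩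
  f 0 + (∑[ _ < n ] 0)                 ≡⟨ cong (f 0 +_) (trans (∑-const n 0) (*-zeroʳ n)) ⟩
  f 0 + 0                              ≡⟨ +-identityʳ (f 0) ⟩
  f 0                                  ∎
∑-δ (suc n) f {suc w} (s≤s w<n) = cong₂ _+_ (*-zeroʳ (f 0)) (∑-δ n (λ x → f (suc x)) w<n)

∑-χ< : ∀ {d k} → d ≤ k → ∑[ x < k ] χ (does (x <? d)) ≡ d
∑-χ< {k = k} z≤n = trans (∑-const k 0) (*-zeroʳ k)
∑-χ< (s≤s d≤k)    = cong suc (∑-χ< d≤k)

χ-<-suc : ∀ t d → χ (does (t <? suc d)) ≡ χ (does (t ≟ d)) + χ (does (t <? d))
χ-<-suc t d with <-cmp t d
... | tri< t<d t≢d _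
  rewrite dec-true (t <? suc d) (m<n⇒m<1+n t<d) | dec-false (t ≟ d) t≢d | dec-true (t <? d) t<d = refl
... | tri≈ _ refl _
  rewrite dec-true (t <? suc t) ≤-refl | dec-true (t ≟ t) refl | dec-false (t <? t) (<-irrefl refl) = refl
... | tri> t≮d t≢d d<t
  rewrite dec-false (t <? suc d) (<⇒≱ d<t ∘ s≤s⁻¹) | dec-false (t ≟ d) t≢d | dec-false (t <? d) t≮d = refl

χ-<-as-∑ : ∀ t d → χ (does (t <? d)) ≡ ∑[ s < d ] χ (does (t ≟ d ∸ suc s))
χ-<-as-∑ t zero    = refl
χ-<-as-∑ t (suc d) = trans (χ-<-suc t d) (cong (χ (does (t ≟ d)) +_) (χ-<-as-∑ t d))

m%n≡r⇔n∣m+k : ∀ {m n r k} .{{_ : NonZero n}} → r < n → n ∣ r + k → (m % n ≡ r ⇔ n ∣ m + k)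
m%n≡r⇔n∣m+k {m} {n} {r} {k} r<n n∣r+k = mk⇔ to from
  where
  to : m % n ≡ r → n ∣ m + k
  to m%n≡r = subst (n ∣_) (sym m+k≡r+k+q*n) (∣m∣n⇒∣m+n n∣r+k (n∣m*n (m / n)))
    where
    m+k≡r+k+q*n : m + k ≡ r + k + m / n * n
    m+k≡r+k+q*n = begin
      m + k                 ≡⟨ cong (_+ k) (m≡m%n+[m/n]*n m n) ⟩
      m % n + m / n * n + k ≡⟨ cong (λ t → t + m / n * n + k) m%n≡r ⟩
      r + m / n * n + k     ≡⟨ xy∙z≈xz∙y r _ k ⟩
      r + k + m / n * n     ∎
  from : n ∣ m + k → m % n ≡ r
  from n∣m+k = begin
    m % n             ≡⟨ %-remove-+ʳ m n∣r+k ⟨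
    (m + (r + k)) % n ≡⟨ cong (_% n) (x∙yz≈y∙xz m r k) ⟩
    (r + (m + k)) % n ≡⟨ %-remove-+ʳ r n∣m+k ⟩
    r % n             ≡⟨ m<n⇒m%n≡m r<n ⟩
    r                 ∎

gcd[m,n]≤m : ∀ m n .{{_ : NonZero m}} → gcd m n ≤ m
gcd[m,n]≤m m n = ∣⇒≤ (gcd[m,n]∣m m n)

∣-nonZero : ∀ {m n} → m ∣ n → .{{NonZero n}} → NonZero m
∣-nonZero {n = n} m∣n = ≢-nonZero λ { refl → ≢-nonZero⁻¹ n (0∣⇒≡0 m∣n) }

-- Correlations of periodic functions

corr : (n : ℕ) (f g : ℕ → ℕ) → ℕ → ℕ
corr n f g w = ∑[ y < n ] g y * f (w + y)

module _ {n : ℕ} .{{_ : NonZero n}} {f : ℕ → ℕ} (f-per : Periodic n f) where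

  corr-periodic : ∀ g → Periodic n (corr n f g)
  corr-periodic g w = ∑-cong′ n λ y → cong (g y *_) (trans (cong f (xy∙z≈xz∙y w n y)) (f-per (w + y)))

  ∑-corr : ∀ g → ∑[ w < n ] corr n f g w ≡ ∑< n f * ∑< n g
  ∑-corr g = begin
    ∑[ w < n ] ∑[ y < n ] g y * f (w + y)   ≡⟨ ∑-comm n n _ ⟩
    ∑[ y < n ] ∑[ w < n ] g y * f (w + y)   ≡⟨ ∑-cong′ n (λ y → *-distribˡ-∑ n (g y) _) ⟨
    ∑[ y < n ] g y * (∑[ w < n ] f (w + y)) ≡⟨ ∑-cong′ n (λ y → cong (g y *_) (∑-f-shift y)) ⟩
    ∑[ y < n ] g y * ∑< n f                 ≡⟨ ∑-cong′ n (λ y → *-comm (g y) _) ⟩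
    ∑[ y < n ] ∑< n f * g y                 ≡⟨ *-distribˡ-∑ n (∑< n f) g ⟨
    ∑< n f * ∑< n g                         ∎
    where
    ∑-f-shift : ∀ y → ∑[ w < n ] f (w + y) ≡ ∑< n f
    ∑-f-shift y = trans (∑-cong′ n (λ w → cong f (+-comm w y))) (∑-shift n f-per y)

  -- pred n * w is −w modulo n.
  corr-flip : ∀ {g} → Periodic n g → ∀ w → corr n g f w ≡ corr n f g (pred n * w)
  corr-flip {g} g-per w = begin
    ∑[ y < n ] f y * g (w + y)  ≡⟨ ∑-shift n h-per c ⟨
    ∑[ y < n ] h (c + y)        ≡⟨ ∑-cong′ n (λ y → cong (f (c + y) *_) (g-wrap y)) ⟩
    ∑[ y < n ] f (c + y) * g y  ≡⟨ ∑-cong′ n (λ y → *-comm (f (c + y)) (g y)) ⟩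
    ∑[ y < n ] g y * f (c + y)  ∎
    where
    c = pred n * w
    h : ℕ → ℕ
    h y = f y * g (w + y)
    h-per : Periodic n h
    h-per y = cong₂ _*_ (f-per y) (trans (cong g (sym (+-assoc w y n))) (g-per (w + y)))
    g-wrap : ∀ y → g (w + (c + y)) ≡ g y
    g-wrap y = begin
      g (w + (c + y))          ≡⟨ cong g (+-assoc w c y) ⟨
      g (suc (pred n) * w + y) ≡⟨ cong (λ t → g (t * w + y)) (suc-pred n) ⟩
      g (n * w + y)            ≡⟨ cong g (+-comm (n * w) y) ⟩
      g (y + n * w)            ≡⟨ cong (λ t → g (y + t)) (*-comm n w) ⟩
      g (y + w * n)            ≡⟨ periodic-* g-per w y ⟩
      g y                      ∎

residue< : (a : ℕ) .{{_ : NonZero a}} → ℕ → ℕ → ℕ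
residue< a d m = χ (does (m % a <? d))

divisibleBy : ℕ → ℕ → ℕ
divisibleBy a m = χ (does (a ∣? m))

divisibleBy-periodic : ∀ a → Periodic a (divisibleBy a)
divisibleBy-periodic a m = cong χ (does-⇔ (mk⇔ to from) (a ∣? m + a) (a ∣? m))
  where
  to : a ∣ m + a → a ∣ m
  to a∣m+a = ∣m+n∣m⇒∣n (subst (a ∣_) (+-comm m a) a∣m+a) ∣-refl
  from : a ∣ m → a ∣ m + a
  from a∣m = ∣m∣n⇒∣m+n a∣m ∣-refl

module _ (a : ℕ) .{{_ : NonZero a}} where

  residue<-periodic : ∀ d → Periodic a (residue< a d)
  residue<-periodic d m = cong (λ t → χ (does (t <? d))) ([m+n]%n≡m%n m a)

  ∑-residue< : ∀ {d} → d ≤ a → ∀ q → ∑< (q * a) (residue< a d) ≡ q * d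
  ∑-residue< d≤a zero    = refl
  ∑-residue< {d} d≤a (suc q) = begin
    ∑< (a + q * a) (residue< a d)
      ≡⟨ ∑-++ a (q * a) _ ⟩
    ∑< a (residue< a d) + (∑[ x < q * a ] residue< a d (a + x))
      ≡⟨ cong₂ _+_ one-period (∑-cong′ (q * a) shift) ⟩
    d + ∑< (q * a) (residue< a d)
      ≡⟨ cong (d +_) (∑-residue< d≤a q) ⟩
    d + q * d
      ∎
    where
    one-period : ∑< a (residue< a d) ≡ d
    one-period = trans (∑-cong a (λ x x<a → cong (λ t → χ (does (t <? d))) (m<n⇒m%n≡m x<a))) (∑-χ< d≤a)
    shift : ∀ x → residue< a d (a + x) ≡ residue< a d x
    shift x = trans (cong (residue< a d) (+-comm a x)) (residue<-periodic d x)

  residue<-as-∑ : ∀ {d} → d ≤ a → ∀ m →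
                  residue< a d m ≡ ∑[ s < d ] divisibleBy a (m + (a ∸ d + suc s))
  residue<-as-∑ {d} d≤a m = trans (χ-<-as-∑ (m % a) d) (∑-cong d term)
    where
    term : ∀ s → s < d → χ (does (m % a ≟ d ∸ suc s)) ≡ divisibleBy a (m + (a ∸ d + suc s))
    term s s<d = cong χ (does-⇔ (m%n≡r⇔n∣m+k r<a (subst (a ∣_) (sym r+k≡a) ∣-refl)) (m % a ≟ r) (a ∣? _))
      where
      r = d ∸ suc s
      r+1+s≡d : r + suc s ≡ d
      r+1+s≡d = m∸n+n≡m s<d
      r<a : r < a
      r<a = <-≤-trans (subst (r <_) r+1+s≡d (m<m+n r z<s)) d≤a
      r+k≡a : r + (a ∸ d + suc s) ≡ a
      r+k≡a = begin
        r + (a ∸ d + suc s) ≡⟨ x∙yz≈y∙xz r (a ∸ d) (suc s) ⟩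
        a ∸ d + (r + suc s) ≡⟨ cong (a ∸ d +_) r+1+s≡d ⟩
        a ∸ d + d           ≡⟨ m∸n+n≡m d≤a ⟩
        a                   ∎

module _ {n a b : ℕ} .{{_ : NonZero n}} .{{_ : NonZero a}} (a∣n : a ∣ n) (b∣n : b ∣ n)
         {β : ℕ → ℕ} (β-per : Periodic b β) where

  private
    d = gcd a b

    F : ℕ → ℕ
    F v = ∑[ y < n ] β y * divisibleBy a (v + y)

    F-per-a : Periodic a F
    F-per-a v = ∑-cong′ n λ y →
      cong (β y *_) (trans (cong (divisibleBy a) (xy∙z≈xz∙y v a y)) (divisibleBy-periodic a (v + y)))

    F-per-b : Periodic b F
    F-per-b v = begin
      ∑[ y < n ] β y * divisibleBy a (v + b + y)
        ≡⟨ ∑-cong′ n (λ y → cong₂ _*_ (sym (β-shift y)) (cong (divisibleBy a) (+-assoc v b y))) ⟩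
      ∑[ y < n ] β (b + y) * divisibleBy a (v + (b + y))
        ≡⟨ ∑-shift n G-per b ⟩
      F v
        ∎
      where
      β-shift : ∀ y → β (b + y) ≡ β y
      β-shift y = trans (cong β (+-comm b y)) (β-per y)
      G-per : Periodic n (λ y → β y * divisibleBy a (v + y))
      G-per y = cong₂ _*_ (periodic-∣ b∣n β-per y)
        (trans (cong (divisibleBy a) (sym (+-assoc v y n))) (periodic-∣ a∣n (divisibleBy-periodic a) (v + y)))

    corr≡∑F : ∀ w → corr n (residue< a d) β w ≡ ∑< d F
    corr≡∑F w = begin
      ∑[ y < n ] β y * residue< a d (w + y)
        ≡⟨ ∑-cong′ n (λ y → cong (β y *_) (residue<-as-∑ a d≤a (w + y))) ⟩
      ∑[ y < n ] β y * (∑[ s < d ] divisibleBy a (w + y + (a ∸ d + suc s)))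
        ≡⟨ ∑-cong′ n (λ y → *-distribˡ-∑ d (β y) _) ⟩
      ∑[ y < n ] ∑[ s < d ] β y * divisibleBy a (w + y + (a ∸ d + suc s))
        ≡⟨ ∑-comm n d _ ⟩
      ∑[ s < d ] ∑[ y < n ] β y * divisibleBy a (w + y + (a ∸ d + suc s))
        ≡⟨ ∑-cong′ d (λ s → ∑-cong′ n (λ y → cong (λ t → β y * divisibleBy a t) (regroup s y))) ⟩
      ∑[ s < d ] F (suc (w + (a ∸ d)) + s)
        ≡⟨ ∑-shift d (periodic-gcd F-per-a F-per-b) _ ⟩
      ∑< d F
        ∎
      where
      d≤a : d ≤ a
      d≤a = gcd[m,n]≤m a b
      regroup : ∀ s y → w + y + (a ∸ d + suc s) ≡ suc (w + (a ∸ d)) + s + y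
      regroup s y = solve 4 (λ w y u s → w :+ y :+ (u :+ (con 1 :+ s)) := con 1 :+ (w :+ u) :+ s :+ y)
                            refl w y (a ∸ d) s
        where open +-*-Solver

  corr-residue<-uniform : ∀ w w′ → corr n (residue< a (gcd a b)) β w ≡ corr n (residue< a (gcd a b)) β w′
  corr-residue<-uniform w w′ = trans (corr≡∑F w) (sym (corr≡∑F w′))

-- Subsets of ℤ_n as periodic indicators

sum-tabulate≡∑ : ∀ {k} (h : Fin k → ℕ) (g : ℕ → ℕ) → (∀ i → h i ≡ g (toℕ i)) →
                 sum (tabulate h) ≡ ∑< k g
sum-tabulate≡∑ {zero}  h g eq = refl
sum-tabulate≡∑ {suc k} h g eq = cong₂ _+_ (eq fzero) (sum-tabulate≡∑ (h ∘ fsuc) (g ∘ suc) (eq ∘ fsuc))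

sum-allFin≡∑ : ∀ {k} (h : Fin k → ℕ) (g : ℕ → ℕ) → (∀ i → h i ≡ g (toℕ i)) →
               sum (map h (allFin k)) ≡ ∑< k g
sum-allFin≡∑ {k} h g eq = trans (cong sum (map-tabulate (λ i → i) h)) (sum-tabulate≡∑ h g eq)

∣∣≡∑ : ∀ {k} (S : Subset k) (g : ℕ → ℕ) → (∀ i → χ (lookup S i) ≡ g (toℕ i)) →
       ∣ S ∣ ≡ ∑< k g
∣∣≡∑ []          g eq = refl
∣∣≡∑ (true  ∷ S) g eq = cong₂ _+_ (eq fzero) (∣∣≡∑ S (g ∘ suc) (eq ∘ fsuc))
∣∣≡∑ (false ∷ S) g eq = cong₂ _+_ (eq fzero) (∣∣≡∑ S (g ∘ suc) (eq ∘ fsuc))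

[m%n+k]%n≡[m+k]%n : ∀ m k n .{{_ : NonZero n}} → (m % n + k) % n ≡ (m + k) % n
[m%n+k]%n≡[m+k]%n m k n = begin
  (m % n + k) % n             ≡⟨ [m+kn]%n≡m%n (m % n + k) (m / n) n ⟨
  (m % n + k + m / n * n) % n ≡⟨ cong (_% n) (xy∙z≈xz∙y (m % n) k _) ⟩
  (m % n + m / n * n + k) % n ≡⟨ cong (λ t → (t + k) % n) (m≡m%n+[m/n]*n m n) ⟨
  (m + k) % n                 ∎

module _ {n : ℕ} .{{_ : NonZero n}} where

  toℕ-[]ₙ : ∀ m → toℕ ([_]ₙ {n} m) ≡ m % n
  toℕ-[]ₙ m = toℕ-fromℕ< (m%n<n m n)

  []ₙ-toℕ : ∀ (x : Fin n) → [ toℕ x ]ₙ ≡ x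
  []ₙ-toℕ x = toℕ-injective (trans (toℕ-[]ₙ (toℕ x)) (m<n⇒m%n≡m (toℕ<n x)))

  []ₙ-% : ∀ m → [_]ₙ {n} (m % n) ≡ [ m ]ₙ
  []ₙ-% m = toℕ-injective (trans (toℕ-[]ₙ (m % n)) (trans (m%n%n≡m%n m n) (sym (toℕ-[]ₙ m))))

  ⊖≡⇔ : ∀ (x y z : Fin n) → (x ⊖ y ≡ z ⇔ toℕ x ≡ (toℕ z + toℕ y) % n)
  ⊖≡⇔ x y z = mk⇔ to from
    where
    y≤n = <⇒≤ (toℕ<n y)
    to : x ⊖ y ≡ z → toℕ x ≡ (toℕ z + toℕ y) % n
    to refl = sym (begin
      (toℕ (x ⊖ y) + toℕ y) % n
        ≡⟨ cong (λ t → (t + toℕ y) % n) (toℕ-[]ₙ _) ⟩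
      ((toℕ x + (n ∸ toℕ y)) % n + toℕ y) % n
        ≡⟨ [m%n+k]%n≡[m+k]%n _ (toℕ y) n ⟩
      (toℕ x + (n ∸ toℕ y) + toℕ y) % n
        ≡⟨ cong (_% n) (trans (+-assoc (toℕ x) _ _) (cong (toℕ x +_) (m∸n+n≡m y≤n))) ⟩
      (toℕ x + n) % n
        ≡⟨ [m+n]%n≡m%n (toℕ x) n ⟩
      toℕ x % n
        ≡⟨ m<n⇒m%n≡m (toℕ<n x) ⟩
      toℕ x
        ∎)
    from : toℕ x ≡ (toℕ z + toℕ y) % n → x ⊖ y ≡ z
    from eq = toℕ-injective (begin
      toℕ (x ⊖ y)
        ≡⟨ toℕ-[]ₙ _ ⟩
      (toℕ x + (n ∸ toℕ y)) % n
        ≡⟨ cong (λ t → (t + (n ∸ toℕ y)) % n) eq ⟩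
      ((toℕ z + toℕ y) % n + (n ∸ toℕ y)) % n
        ≡⟨ [m%n+k]%n≡[m+k]%n _ (n ∸ toℕ y) n ⟩
      (toℕ z + toℕ y + (n ∸ toℕ y)) % n
        ≡⟨ cong (_% n) (trans (+-assoc (toℕ z) _ _) (cong (toℕ z +_) (m+[n∸m]≡n y≤n))) ⟩
      (toℕ z + n) % n
        ≡⟨ [m+n]%n≡m%n (toℕ z) n ⟩
      toℕ z % n
        ≡⟨ m<n⇒m%n≡m (toℕ<n z) ⟩
      toℕ z
        ∎)

  𝟙[_] : Subset n → ℕ → ℕ
  𝟙[ A ] m = χ (lookup A [ m ]ₙ)

  𝟙-periodic : ∀ A → Periodic n 𝟙[ A ]
  𝟙-periodic A m = cong (χ ∘ lookup A) (begin
    [ m + n ]ₙ        ≡⟨ []ₙ-% (m + n) ⟨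
    [ (m + n) % n ]ₙ  ≡⟨ cong [_]ₙ ([m+n]%n≡m%n m n) ⟩
    [ m % n ]ₙ        ≡⟨ []ₙ-% m ⟩
    [ m ]ₙ            ∎)

  𝟙-toℕ : ∀ A (x : Fin n) → 𝟙[ A ] (toℕ x) ≡ χ (lookup A x)
  𝟙-toℕ A x = cong (χ ∘ lookup A) ([]ₙ-toℕ x)

  ∣∣≡∑𝟙 : ∀ A → ∣ A ∣ ≡ ∑< n 𝟙[ A ]
  ∣∣≡∑𝟙 A = ∣∣≡∑ A 𝟙[ A ] (sym ∘ 𝟙-toℕ A)

  Δ-count≡corr : ∀ A B z → Δ-count A B z ≡ corr n 𝟙[ A ] 𝟙[ B ] (toℕ z)
  Δ-count≡corr A B z = begin
    Δ-count A B z
      ≡⟨ sum-allFin≡∑ _ _ (λ x → sum-allFin≡∑ _ _ (term x)) ⟩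
    ∑[ x < n ] ∑[ y < n ] 𝟙[ B ] y * (𝟙[ A ] x * δ x y)
      ≡⟨ ∑-comm n n _ ⟩
    ∑[ y < n ] ∑[ x < n ] 𝟙[ B ] y * (𝟙[ A ] x * δ x y)
      ≡⟨ ∑-cong′ n (λ y → *-distribˡ-∑ n (𝟙[ B ] y) _) ⟨
    ∑[ y < n ] 𝟙[ B ] y * (∑[ x < n ] 𝟙[ A ] x * δ x y)
      ≡⟨ ∑-cong′ n (λ y → cong (𝟙[ B ] y *_) (∑-δ n 𝟙[ A ] (m%n<n _ n))) ⟩
    ∑[ y < n ] 𝟙[ B ] y * 𝟙[ A ] ((toℕ z + y) % n)
      ≡⟨ ∑-cong′ n (λ y → cong (𝟙[ B ] y *_) (periodic-% (𝟙-periodic A) _)) ⟩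
    corr n 𝟙[ A ] 𝟙[ B ] (toℕ z)
      ∎
    where
    δ : ℕ → ℕ → ℕ
    δ x y = χ (does (x ≟ (toℕ z + y) % n))
    term : ∀ x y → χ (lookup A x ∧ lookup B y ∧ does ((x ⊖ y) ≟ᶠ z))
                 ≡ 𝟙[ B ] (toℕ y) * (𝟙[ A ] (toℕ x) * δ (toℕ x) (toℕ y))
    term x y = begin
      χ (Ax ∧ By ∧ does ((x ⊖ y) ≟ᶠ z))       ≡⟨ trans (χ-∧ Ax _) (cong (χ Ax *_) (χ-∧ By _)) ⟩
      χ Ax * (χ By * χ (does ((x ⊖ y) ≟ᶠ z))) ≡⟨ cong (λ t → χ Ax * (χ By * χ t)) ⊖-does ⟩
      χ Ax * (χ By * δ (toℕ x) (toℕ y))       ≡⟨ x*yz≡y*xz (χ Ax) (χ By) _ ⟩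
      χ By * (χ Ax * δ (toℕ x) (toℕ y))
        ≡⟨ cong₂ (λ s t → s * (t * δ (toℕ x) (toℕ y))) (𝟙-toℕ B y) (𝟙-toℕ A x) ⟨
      𝟙[ B ] (toℕ y) * (𝟙[ A ] (toℕ x) * δ (toℕ x) (toℕ y)) ∎
      where
      Ax = lookup A x
      By = lookup B y
      ⊖-does : does ((x ⊖ y) ≟ᶠ z) ≡ does (toℕ x ≟ (toℕ z + toℕ y) % n)
      ⊖-does = does-⇔ (⊖≡⇔ x y z) ((x ⊖ y) ≟ᶠ z) (toℕ x ≟ (toℕ z + toℕ y) % n)

  Δ-count-[]ₙ : ∀ A B m → Δ-count A B [ m ]ₙ ≡ corr n 𝟙[ A ] 𝟙[ B ] m
  Δ-count-[]ₙ A B m = begin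
    Δ-count A B [ m ]ₙ                ≡⟨ Δ-count≡corr A B [ m ]ₙ ⟩
    corr n 𝟙[ A ] 𝟙[ B ] (toℕ [ m ]ₙ) ≡⟨ cong (corr n 𝟙[ A ] 𝟙[ B ]) (toℕ-[]ₙ m) ⟩
    corr n 𝟙[ A ] 𝟙[ B ] (m % n)      ≡⟨ periodic-% (corr-periodic (𝟙-periodic A) 𝟙[ B ]) m ⟩
    corr n 𝟙[ A ] 𝟙[ B ] m            ∎

  Δ-uniform : Subset n → Subset n → Set
  Δ-uniform A B = ∀ z z′ → Δ-count A B z ≡ Δ-count A B z′

  Δ-uniform-sym : ∀ {A B} → Δ-uniform A B → Δ-uniform B A
  Δ-uniform-sym {A} {B} uniform z z′ = trans (flip z) (trans (uniform _ _) (sym (flip z′)))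
    where
    flip : ∀ z → Δ-count B A z ≡ Δ-count A B [ pred n * toℕ z ]ₙ
    flip z = begin
      Δ-count B A z                         ≡⟨ Δ-count≡corr B A z ⟩
      corr n 𝟙[ B ] 𝟙[ A ] (toℕ z)          ≡⟨ corr-flip (𝟙-periodic A) (𝟙-periodic B) (toℕ z) ⟩
      corr n 𝟙[ A ] 𝟙[ B ] (pred n * toℕ z) ≡⟨ Δ-count-[]ₙ A B _ ⟨
      Δ-count A B [ pred n * toℕ z ]ₙ       ∎

  Δ-uniform⇒Δ-count*n≡∣A∣*∣B∣ : ∀ {A B} → Δ-uniform A B → ∀ z → Δ-count A B z * n ≡ ∣ A ∣ * ∣ B ∣
  Δ-uniform⇒Δ-count*n≡∣A∣*∣B∣ {A} {B} uniform z = begin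
    Δ-count A B z * n                 ≡⟨ *-comm _ n ⟩
    n * Δ-count A B z                 ≡⟨ ∑-const n _ ⟨
    ∑[ _ < n ] Δ-count A B z          ≡⟨ ∑-cong′ n (λ w → trans (uniform z [ w ]ₙ) (Δ-count-[]ₙ A B w)) ⟩
    ∑[ w < n ] corr n 𝟙[ A ] 𝟙[ B ] w ≡⟨ ∑-corr (𝟙-periodic A) 𝟙[ B ] ⟩
    ∑< n 𝟙[ A ] * ∑< n 𝟙[ B ]         ≡⟨ cong₂ _*_ (∣∣≡∑𝟙 A) (∣∣≡∑𝟙 B) ⟨
    ∣ A ∣ * ∣ B ∣                     ∎

uniform⇒IsGPSEDF : ∀ {n m} .{{_ : NonZero n}} (A : Fin m → Subset n) (k : Fin m → ℕ) →
                   (∀ i → ∣ A i ∣ ≡ k i) → (∀ i j → ¬ (i ≡ j) → Δ-uniform (A i) (A j)) →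
                   ∀ z₀ → IsGPSEDF n m A k (λ i j → Δ-count (A i) (A j) z₀)
uniform⇒IsGPSEDF A k sizes uniform z₀ = record
  { sizes   = sizes
  ; λ-value = λ i j i≢j → trans (Δ-uniform⇒Δ-count*n≡∣A∣*∣B∣ {A = A i} {B = A j} (uniform i j i≢j) z₀)
                                (cong₂ _*_ (sizes i) (sizes j))
  ; Δ-exact = λ i j i≢j z → uniform i j i≢j z z₀
  }

-- Unions of cosets of aℤ_n

∈-⋃⁺ : ∀ {k} {x : Fin k} {p ps} → p ∈ˡ ps → x ∈ p → x ∈ ⋃ ps
∈-⋃⁺ (here refl) x∈p = x∈p∪q⁺ (inj₁ x∈p)
∈-⋃⁺ (there p∈ps) x∈p = x∈p∪q⁺ (inj₂ (∈-⋃⁺ p∈ps x∈p))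

∈-⋃⁻ : ∀ {k} {x : Fin k} ps → x ∈ ⋃ ps → ∃[ p ] p ∈ˡ ps × x ∈ p
∈-⋃⁻ List.[]       x∈⊥ = ⊥-elim (∉⊥ x∈⊥)
∈-⋃⁻ (p List.∷ ps) x∈⋃ with x∈p∪q⁻ p (⋃ ps) x∈⋃
... | inj₁ x∈p = p , here refl , x∈p
... | inj₂ x∈⋃ps with ∈-⋃⁻ ps x∈⋃ps
...   | q , q∈ps , x∈q = q , there q∈ps , x∈q

lookup≡does : ∀ {k} {p : Subset k} {x} {P : Set} → (x ∈ p ⇔ P) → (P? : Dec P) → lookup p x ≡ does P?
lookup≡does {p = p} {x} x∈p⇔P P? with lookup p x in eq | P?
... | true  | yes _  = refl
... | false | no  _  = refl
... | true  | no ¬P  = ⊥-elim (¬P (Equivalence.to x∈p⇔P (lookup⇒[]= x p eq)))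
... | false | yes Px with () ← trans (sym eq) ([]=⇒lookup (Equivalence.from x∈p⇔P Px))

module _ {n : ℕ} .{{_ : NonZero n}} where

  private
    translate : ℕ → Subset n → Fin n → Subset n
    translate r S s = if lookup S s then ⁅ [ r + toℕ s ]ₙ ⁆ else ⊥

  ∈-+ˢ⁺ : ∀ {S : Subset n} {x s} r → s ∈ S → x ≡ [ r + toℕ s ]ₙ → x ∈ r +ˢ S
  ∈-+ˢ⁺ {S} {s = s} r s∈S refl = ∈-⋃⁺ (∈-map⁺ _ (∈-allFin s)) x∈term
    where
    x∈term : [ r + toℕ s ]ₙ ∈ translate r S s
    x∈term rewrite []=⇒lookup s∈S = x∈⁅x⁆ _

  ∈-+ˢ⁻ : ∀ {S : Subset n} {x} r → x ∈ r +ˢ S → ∃[ s ] s ∈ S × x ≡ [ r + toℕ s ]ₙ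
  ∈-+ˢ⁻ {S} r x∈r+S with ∈-⋃⁻ (map (translate r S) (allFin n)) x∈r+S
  ... | _ , p∈ , x∈p with ∈-map⁻ (translate r S) p∈
  ...   | s , _ , refl with lookup S s in eq
  ...     | true  = s , lookup⇒[]= s S eq , x∈⁅y⁆⇒x≡y _ x∈p
  ...     | false = ⊥-elim (∉⊥ x∈p)

  module _ {a : ℕ} .{{_ : NonZero a}} (a∣n : a ∣ n) where

    ∈-ℤ⁺ : ∀ {x} → a ∣ toℕ x → x ∈ a ℤ[ n ]
    ∈-ℤ⁺ {x} (divides q x≡q*a) =
      ∈-⋃⁺ (∈-map⁺ _ (∈-upTo⁺ q<n)) (subst (λ y → x ∈ ⁅ y ⁆) x≡[q*a] (x∈⁅x⁆ x))
      where
      q<n : q < n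
      q<n = ≤-<-trans (m≤m*n q a) (subst (_< n) x≡q*a (toℕ<n x))
      x≡[q*a] : x ≡ [ q * a ]ₙ
      x≡[q*a] = trans (sym ([]ₙ-toℕ x)) (cong [_]ₙ x≡q*a)

    ∈-ℤ⁻ : ∀ {x} → x ∈ a ℤ[ n ] → a ∣ toℕ x
    ∈-ℤ⁻ {x} x∈aℤ with ∈-⋃⁻ (map (λ t → ⁅ [ t * a ]ₙ ⁆) (upTo n)) x∈aℤ
    ... | _ , p∈ , x∈p with ∈-map⁻ (λ t → ⁅ [ t * a ]ₙ ⁆) p∈
    ...   | t , _ , refl = m%n≡0⇒n∣m (toℕ x) a (begin
      toℕ x % a           ≡⟨ cong (λ y → toℕ y % a) (x∈⁅y⁆⇒x≡y _ x∈p) ⟩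
      toℕ [ t * a ]ₙ % a  ≡⟨ cong (_% a) (toℕ-[]ₙ (t * a)) ⟩
      t * a % n % a       ≡⟨ m∣n⇒o%n%m≡o%m a n (t * a) a∣n ⟩
      t * a % a           ≡⟨ m*n%n≡0 t a ⟩
      0                   ∎)

    ∈-coset⇔ : ∀ {x r} → r < a → (x ∈ r +ˢ (a ℤ[ n ]) ⇔ toℕ x % a ≡ r)
    ∈-coset⇔ {x} {r} r<a = mk⇔ to from
      where
      to : x ∈ r +ˢ (a ℤ[ n ]) → toℕ x % a ≡ r
      to x∈ with ∈-+ˢ⁻ r x∈
      ... | s , s∈aℤ , refl = begin
        toℕ [ r + toℕ s ]ₙ % a ≡⟨ cong (_% a) (toℕ-[]ₙ (r + toℕ s)) ⟩
        (r + toℕ s) % n % a    ≡⟨ m∣n⇒o%n%m≡o%m a n (r + toℕ s) a∣n ⟩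
        (r + toℕ s) % a        ≡⟨ %-remove-+ʳ r (∈-ℤ⁻ s∈aℤ) ⟩
        r % a                  ≡⟨ m<n⇒m%n≡m r<a ⟩
        r                      ∎
      from : toℕ x % a ≡ r → x ∈ r +ˢ (a ℤ[ n ])
      from x%a≡r = ∈-+ˢ⁺ r (∈-ℤ⁺ (subst (a ∣_) (sym toℕ-s) (n∣m*n (toℕ x / a)))) x≡[r+s]
        where
        s : Fin n
        s = fromℕ< (≤-<-trans (m/n*n≤m (toℕ x) a) (toℕ<n x))
        toℕ-s : toℕ s ≡ toℕ x / a * a
        toℕ-s = toℕ-fromℕ< _
        x≡[r+s] : x ≡ [ r + toℕ s ]ₙ
        x≡[r+s] = begin
          x                              ≡⟨ []ₙ-toℕ x ⟨
          [ toℕ x ]ₙ                     ≡⟨ cong [_]ₙ (m≡m%n+[m/n]*n (toℕ x) a) ⟩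
          [ toℕ x % a + toℕ x / a * a ]ₙ ≡⟨ cong₂ (λ u v → [ u + v ]ₙ) x%a≡r (sym toℕ-s) ⟩
          [ r + toℕ s ]ₙ                 ∎

-- H n a i unfolds to Cosets n (a i) (gcd (a i) (a (next i))).
Cosets : (n : ℕ) .{{_ : NonZero n}} → ℕ → ℕ → Subset n
Cosets n a d = ⋃ (map (λ r → r +ˢ (a ℤ[ n ])) (upTo d))

module _ {n a d : ℕ} .{{_ : NonZero n}} .{{_ : NonZero a}} (a∣n : a ∣ n) (d≤a : d ≤ a) where

  ∈-Cosets⇔ : ∀ {x} → (x ∈ Cosets n a d ⇔ toℕ x % a < d)
  ∈-Cosets⇔ {x} = mk⇔ to from
    where
    to : x ∈ Cosets n a d → toℕ x % a < d
    to x∈ with ∈-⋃⁻ (map (λ r → r +ˢ (a ℤ[ n ])) (upTo d)) x∈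
    ... | _ , p∈ , x∈p with ∈-map⁻ (λ r → r +ˢ (a ℤ[ n ])) p∈
    ...   | r , r∈ , refl = subst (_< d) (sym (Equivalence.to (∈-coset⇔ a∣n r<a) x∈p)) r<d
      where
      r<d = ∈-upTo⁻ r∈
      r<a = <-≤-trans r<d d≤a
    from : toℕ x % a < d → x ∈ Cosets n a d
    from lt = ∈-⋃⁺ (∈-map⁺ _ (∈-upTo⁺ lt)) (Equivalence.from (∈-coset⇔ a∣n (m%n<n (toℕ x) a)) refl)

  𝟙-Cosets : ∀ m → 𝟙[ Cosets n a d ] m ≡ residue< a d m
  𝟙-Cosets m = cong χ (begin
    lookup (Cosets n a d) [ m ]ₙ     ≡⟨ lookup≡does ∈-Cosets⇔ (toℕ [ m ]ₙ % a <? d) ⟩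
    does (toℕ [ m ]ₙ % a <? d)       ≡⟨ cong (λ t → does (t % a <? d)) (toℕ-[]ₙ m) ⟩
    does (m % n % a <? d)            ≡⟨ cong (λ t → does (t <? d)) (m∣n⇒o%n%m≡o%m a n m a∣n) ⟩
    does (m % a <? d)                ∎)

  ∣Cosets∣ : ∣ Cosets n a d ∣ ≡ quotient a∣n * d
  ∣Cosets∣ = begin
    ∣ Cosets n a d ∣                       ≡⟨ ∣∣≡∑𝟙 (Cosets n a d) ⟩
    ∑< n 𝟙[ Cosets n a d ]                 ≡⟨ ∑-cong′ n 𝟙-Cosets ⟩
    ∑< n (residue< a d)                    ≡⟨ cong (λ k → ∑< k (residue< a d)) (_∣_.equality a∣n) ⟩
    ∑< (quotient a∣n * a) (residue< a d)   ≡⟨ ∑-residue< a d≤a (quotient a∣n) ⟩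
    quotient a∣n * d                       ∎

Cosets-Δ-uniform : ∀ {n a b h} .{{_ : NonZero n}} .{{_ : NonZero a}} .{{_ : NonZero b}} →
                   a ∣ n → b ∣ n → h ≤ b →
                   Δ-uniform (Cosets n a (gcd a b)) (Cosets n b h)
Cosets-Δ-uniform {n} {a} {b} {h} a∣n b∣n h≤b z z′ =
  trans (Δ≡corr z) (trans (corr-residue<-uniform a∣n b∣n 𝟙B-periodic _ _) (sym (Δ≡corr z′)))
  where
  A = Cosets n a (gcd a b)
  B = Cosets n b h
  𝟙B-periodic : Periodic b 𝟙[ B ]
  𝟙B-periodic m =
    trans (𝟙-Cosets b∣n h≤b (m + b)) (trans (residue<-periodic b h m) (sym (𝟙-Cosets b∣n h≤b m)))
  Δ≡corr : ∀ z → Δ-count A B z ≡ corr n (residue< a (gcd a b)) 𝟙[ B ] (toℕ z)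
  Δ≡corr z = trans (Δ-count≡corr A B z)
    (∑-cong′ n (λ y → cong (𝟙[ B ] y *_) (𝟙-Cosets a∣n (gcd[m,n]≤m a b) (toℕ z + y))))

λ*lcm≡n*gcd : ∀ {n a b h L} .{{_ : NonZero n}} .{{_ : NonZero a}} (a∣n : a ∣ n) (b∣n : b ∣ n) →
              L * n ≡ (quotient a∣n * gcd a b) * (quotient b∣n * h) → L * lcm a b ≡ n * h
λ*lcm≡n*gcd {n} {a} {b} {h} {L} a∣n b∣n L*n≡k*k′ = *-cancelʳ-≡ _ _ (g * n) {{g*n≢0}} (begin
  L * lcm a b * (g * n)
    ≡⟨ solve 4 (λ L l g n → L :* l :* (g :* n) := L :* n :* (g :* l)) refl L (lcm a b) g n ⟩
  L * n * (g * lcm a b)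
    ≡⟨ cong₂ _*_ L*n≡k*k′ (gcd*lcm a b) ⟩
  qa * g * (qb * h) * (a * b)
    ≡⟨ solve 6 (λ qa g qb h a b → qa :* g :* (qb :* h) :* (a :* b) := qa :* a :* (qb :* b) :* (g :* h))
               refl qa g qb h a b ⟩
  qa * a * (qb * b) * (g * h)
    ≡⟨ cong₂ (λ s t → s * t * (g * h)) (_∣_.equality a∣n) (_∣_.equality b∣n) ⟨
  n * n * (g * h)
    ≡⟨ solve 3 (λ n g h → n :* n :* (g :* h) := n :* h :* (g :* n)) refl n g h ⟩
  n * h * (g * n)
    ∎)
  where
  open +-*-Solver
  g = gcd a b
  qa = quotient a∣n
  qb = quotient b∣n
  g*n≢0 : NonZero (g * n)
  g*n≢0 = m*n≢0 g n {{≢-nonZero (gcd[m,n]≢0 a b (inj₁ (≢-nonZero⁻¹ a)))}}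

next≢id : ∀ i → ¬ (next i ≡ i)
next≢id fzero               ()
next≢id (fsuc fzero)        ()
next≢id (fsuc (fsuc fzero)) ()

adjacent : ∀ i j → ¬ (i ≡ j) → j ≡ next i ⊎ i ≡ next j
adjacent fzero               fzero               i≢j = ⊥-elim (i≢j refl)
adjacent fzero               (fsuc fzero)        _   = inj₁ refl
adjacent fzero               (fsuc (fsuc fzero)) _   = inj₂ refl
adjacent (fsuc fzero)        fzero               _   = inj₂ refl
adjacent (fsuc fzero)        (fsuc fzero)        i≢j = ⊥-elim (i≢j refl)
adjacent (fsuc fzero)        (fsuc (fsuc fzero)) _   = inj₁ refl
adjacent (fsuc (fsuc fzero)) fzero               _   = inj₁ refl
adjacent (fsuc (fsuc fzero)) (fsuc fzero)        _   = inj₂ refl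
adjacent (fsuc (fsuc fzero)) (fsuc (fsuc fzero)) i≢j = ⊥-elim (i≢j refl)

cyclic-uniform : ∀ {n} .{{_ : NonZero n}} (A : Fin 3 → Subset n) →
                 (∀ i → Δ-uniform (A i) (A (next i))) → ∀ i j → ¬ (i ≡ j) → Δ-uniform (A i) (A j)
cyclic-uniform A uniform i j i≢j with adjacent i j i≢j
... | inj₁ refl = uniform i
... | inj₂ refl = Δ-uniform-sym {A = A j} {B = A i} (uniform j)

corollary4p10 : (n : ℕ) .{{_ : NonZero n}} (a : Fin 3 → ℕ)
    → (div : ∀ i → a i ∣ n)
    → (∀ i j → ¬ (i ≡ j) → ¬ (a i ≡ a j))
    → Σ (Fin 3 → Fin 3 → ℕ) λ lam →
        IsGPSEDF n 3 (H n a) (λ i → quotient (div i) * gcd (a i) (a (next i))) lam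
        × (∀ i → (lam i (next i) * lcm (a i) (a (next i)) ≡ n * gcd (a (next i)) (a (next (next i))))
               × (lam (next i) i * lcm (a i) (a (next i)) ≡ n * gcd (a (next i)) (a (next (next i)))))
corollary4p10 n a div _ = lam , gpsedf , λ i →
    λ*lcm≡n*gcd {L = lam i (next i)} (div i) (div (next i)) (λ-value i (next i) (next≢id i ∘ sym))
  , λ*lcm≡n*gcd {L = lam (next i) i} (div i) (div (next i))
      (trans (λ-value (next i) i (next≢id i)) (*-comm (k (next i)) (k i)))
  where
  instance
    a-nonZero : ∀ {i} → NonZero (a i)
    a-nonZero {i} = ∣-nonZero (div i)

  k : Fin 3 → ℕ
  k i = quotient (div i) * gcd (a i) (a (next i))

  lam : Fin 3 → Fin 3 → ℕ
  lam i j = Δ-count (H n a i) (H n a j) [ 0 ]ₙ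

  gpsedf : IsGPSEDF n 3 (H n a) k lam
  gpsedf = uniform⇒IsGPSEDF (H n a) k
    (λ i → ∣Cosets∣ (div i) (gcd[m,n]≤m (a i) _))
    (cyclic-uniform (H n a) (λ i → Cosets-Δ-uniform (div i) (div (next i)) (gcd[m,n]≤m (a (next i)) _)))
    [ 0 ]ₙ

  open IsGPSEDF gpsedf using (λ-value)
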